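{- Let $\mathcal G=(V,\mathcal E)$ be a graph (loops allowed) such that $\mathcal G^0$ is a disjoint union of $n$ copies of $K_3$ for some $n\ge 2$. Then $\mathcal G$ is join-irreducible if and only if $\mathcal G=\mathcal G^0$ (i.e. $\mathcal G$ has no loops).
   Context: A graph $\mathcal G=(V,\mathcal E)$ has finite vertex set $V=\{1,\dots,n\}$ and $\mathcal E\subseteq[V]^2\cup[V]^1$ (singletons are loops); $\mathcal G^0=(V,\mathcal E\cap[V]^2)$. $f_{\mathcal G}$ is the Boolean function computed by the $GF(2)$ polynomial $\sum_{E\in\mathcal E}\prod_{i\in E}x_i$, and $\mathcal G$ is join-irreducible if $f_{\mathcal G}$ is. For Boolean functions, $g\le f$ if there is $\sigma$ with $g(a_1,\dots,a_m)=f(a_{\sigma(1)},\dots,a_{\sigma(n)})$ for all $a_i$; $g<f$ if $g\le f$ and $f\not\le g$; $f$ is join-irreducible if some $f'<f$ satisfies $g\le f'$ for all $g<f$. $K_3$ is the complete graph on 3 vertices. -}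

module Defs where

open import Data.Nat using (ℕ)
open import Data.Bool using (Bool; true; false; _∧_; _xor_)
open import Data.Fin using (Fin; _<?_)
open import Data.Fin.Properties using ()
open import Data.List using (List; foldr; map; concatMap; filter; allFin)
open import Data.Product using (Σ; ∃; _×_; _,_; proj₁)
open import Function.Bundles using (_↔_; _⇔_; Inverse)
open import Relation.Binary.PropositionalEquality using (_≡_; _≢_)
open import Relation.Nullary using (¬_)

BF : ℕ → Set
BF m = (Fin m → Bool) → Bool

BoolFun : Set
BoolFun = Σ ℕ BF

_≼_ : BoolFun → BoolFun → Set
(m , g) ≼ (n , f) = Σ (Fin n → Fin m) λ σ → ∀ (a : Fin m → Bool) → g a ≡ f (λ i → a (σ i))

_≺_ : BoolFun → BoolFun → Set
g ≺ f = (g ≼ f) × ¬ (f ≼ g)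

JoinIrreducible : BoolFun → Set
JoinIrreducible f = Σ BoolFun λ f' → (f' ≺ f) × (∀ g → g ≺ f → g ≼ f')

record Graph (N : ℕ) : Set where
  field
    adj    : Fin N → Fin N → Bool     -- 2-element edges {i,j}
    adj-sym : ∀ i j → adj i j ≡ adj j i
    adj-irr : ∀ i → adj i i ≡ false
    loop   : Fin N → Bool             -- singleton edges {i}

open Graph public

xorSum : List Bool → Bool
xorSum = foldr _xor_ false

fG : ∀ {N} → Graph N → BF N
fG {N} G x =
  xorSum (map (λ i → loop G i ∧ x i) (allFin N))
  xor
  xorSum (concatMap (λ i → map (λ j → adj G i j ∧ (x i ∧ x j))
                               (filter (λ j → i <? j) (allFin N)))
                    (allFin N))

boolFunOf : ∀ {N} → Graph N → BoolFun
boolFunOf {N} G = N , fG G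

GraphJoinIrreducible : ∀ {N} → Graph N → Set
GraphJoinIrreducible G = JoinIrreducible (boolFunOf G)

UnderlyingIsDisjointK3s : ∀ {N} → Graph N → ℕ → Set
UnderlyingIsDisjointK3s {N} G n =
  Σ (Fin N ↔ (Fin n × Fin 3)) λ e →
    ∀ i j → (adj G i j ≡ true) ⇔
            ((i ≢ j) × (proj₁ (Inverse.to e i) ≡ proj₁ (Inverse.to e j)))

Loopless : ∀ {N} → Graph N → Set
Loopless {N} G = ∀ (i : Fin N) → loop G i ≡ false

-- Write f for f_G and f_kl for the minor of f that identifies variable l with k.  Every variable of f
-- is essential, so every g < f lies below some f_ij with i ≠ j, and f is join-irreducible precisely
-- when one f_kl lies above all the f_ij.  Everything is read off the derivatives
-- ∂_w f(y) = f(y + e_w) + f(y) = loop(w) + y(w′) + y(w″), where w′, w″ are the other two vertices of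
-- the triangle of w.  Without loops, f_ij for i, j in one triangle lies below some f_is with s in
-- another triangle, and the symmetries of f that permute and rotate the triangles carry every pair
-- across triangles to one fixed pair.  With a loop, f_ij and f_kl are told apart by which variables
-- have constant derivative, by the constant terms of these derivatives, and by how many variables the
-- merged variable interacts with.

module Submission where

open import Defs
open import Algebra.Bundles using (CommutativeRing)
open import Data.Bool using (Bool; true; false; _∧_; _xor_; if_then_else_)
open import Data.Bool.Properties
  using (xor-∧-commutativeRing; xor-assoc; xor-comm; xor-identityʳ; xor-same;
         ∧-assoc; ∧-comm; ∧-zeroʳ; ∧-distribˡ-xor; ∧-distribʳ-xor; ¬-not)
  renaming (_≟_ to _≟ᵇ_)
open import Algebra.Properties.Semiring.Sum (CommutativeRing.semiring xor-∧-commutativeRing)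
  using (sum-syntax; sum-cong-≗; ∑-distrib-+; *-distribˡ-sum; sum-replicate-zero)
open import Data.Empty using (⊥)
open import Data.Fin using (Fin; zero; suc; _<?_; punchIn; punchOut)
open import Data.Fin.Permutation using (Permutation′; _⟨$⟩ʳ_; _⟨$⟩ˡ_; inverseˡ; inverseʳ; transpose; _∘ₚ_)
import Data.Fin.Permutation.Components as PC
open import Data.Fin.Properties
  using (_≟_; <-cmp; <-irrefl; <-asym; any?; all?; punchIn-punchOut; punchInᵢ≢i; punchIn-injective;
         injective⇒≤)
open import Data.List using (List; []; _∷_; _++_; map; concatMap; filter; tabulate; allFin)
open import Data.List.Membership.Propositional using (_∈_)
open import Data.List.Membership.Propositional.Properties using (∈-allFin)
open import Data.List.Relation.Unary.Any using (here; there)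
open import Data.Maybe using (Maybe; just; nothing)
open import Data.Nat as ℕ using (ℕ; zero; suc; _≥_; s≤s)
open import Data.Nat.Properties using (1+n≰n)
open import Data.Product using (Σ; ∃; ∃₂; _×_; _,_; proj₁; proj₂)
open import Data.Sum using (_⊎_; inj₁; inj₂; [_,_]′)
open import Function using (_∘_; const)
open import Function.Bundles using (_↔_; _⇔_; mk⇔; Inverse; Equivalence)
open import Function.Definitions using (Injective)
open import Level using (0ℓ)
open import Relation.Binary.Definitions using (tri<; tri≈; tri>; DecidableEquality)
open import Relation.Binary.PropositionalEquality
open import Relation.Nullary using (¬_; ¬?; Dec; does; yes; no; contradiction)
open import Relation.Nullary.Decidable using (dec-true; dec-false; _×-dec_)
open import Relation.Unary using (Pred; Decidable)
open import Tactic.RingSolver using (solve-∀)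
open import Tactic.RingSolver.Core.AlmostCommutativeRing using (AlmostCommutativeRing; fromCommutativeRing)

private
  -- The zero test lets the solver cancel coefficients 1 + 1, so it proves identities of characteristic two.
  isFalse : ∀ b → Maybe (false ≡ b)
  isFalse false = just refl
  isFalse true  = nothing

  boolRing : AlmostCommutativeRing 0ℓ 0ℓ
  boolRing = fromCommutativeRing xor-∧-commutativeRing isFalse

xor≡false⇒≡ : ∀ {a b} → a xor b ≡ false → a ≡ b
xor≡false⇒≡ {true}  {true}  _ = refl
xor≡false⇒≡ {false} {false} _ = refl

xor-true≢ : ∀ a → a xor true ≢ a
xor-true≢ true  ()
xor-true≢ false ()

xor-separates : ∀ {a b} → a ≢ b → ∀ s p → a xor s ≢ p ⊎ b xor s ≢ p
xor-separates {a} {b} a≢b s p with a xor s ≟ᵇ p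
... | no  a⊕s≢p = inj₁ a⊕s≢p
... | yes a⊕s≡p = inj₂ λ b⊕s≡p →
  a≢b (trans (unshift a s) (trans (cong (_xor s) (trans a⊕s≡p (sym b⊕s≡p))) (sym (unshift b s))))
  where
  unshift : ∀ x s → x ≡ (x xor s) xor s
  unshift = solve-∀ boolRing

-- Derivatives of Boolean functions

toggle : ∀ {N} → (Fin N → Bool) → Fin N → (Fin N → Bool)
toggle y w u = y u xor does (u ≟ w)

∂ : ∀ {N} → BF N → Fin N → BF N
∂ h w y = h (toggle y w) xor h y

∂₂ : ∀ {N} → BF N → Fin N → Fin N → BF N
∂₂ h i j y = h (toggle (toggle y i) j) xor h y

∂₂-split : ∀ {N} (h : BF N) i j y → ∂₂ h i j y ≡ ∂ h j (toggle y i) xor ∂ h i y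
∂₂-split h i j y = telescope (h (toggle (toggle y i) j)) (h (toggle y i)) (h y)
  where
  telescope : ∀ a b c → a xor c ≡ (a xor b) xor (b xor c)
  telescope = solve-∀ boolRing

Congruent : ∀ {N} → BF N → Set
Congruent h = ∀ {x y} → x ≗ y → h x ≡ h y

∂-respects : ∀ {N} {h : BF N} → Congruent h → ∀ w → Congruent (∂ h w)
∂-respects h-cong w y≗y′ = cong₂ _xor_ (h-cong (λ u → cong (_xor does (u ≟ w)) (y≗y′ u))) (h-cong y≗y′)

∂₂-respects : ∀ {N} {h : BF N} → Congruent h → ∀ i j → Congruent (∂₂ h i j)
∂₂-respects h-cong i j y≗y′ = cong₂ _xor_
  (h-cong (λ u → cong (λ b → (b xor does (u ≟ i)) xor does (u ≟ j)) (y≗y′ u))) (h-cong y≗y′)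

∂-cong : ∀ {N} {h h′ : BF N} → h ≗ h′ → ∀ w a → ∂ h w a ≡ ∂ h′ w a
∂-cong h≗h′ w a = cong₂ _xor_ (h≗h′ (toggle a w)) (h≗h′ a)

insensitive-update : ∀ {N} {h : BF N} → Congruent h → ∀ {u y y′} →
                     (∀ v → v ≢ u → y′ v ≡ y v) → ∂ h u y ≡ false → h y′ ≡ h y
insensitive-update h-cong {u} {y} {y′} agree ∂≡false with y′ u ≟ᵇ y u
... | yes same = h-cong (λ v → case v)
  where
  case : ∀ v → y′ v ≡ y v
  case v with v ≟ u
  ... | yes refl = same
  ... | no  v≢u  = agree v v≢u
... | no  differ = trans (h-cong (λ v → case v)) (xor≡false⇒≡ ∂≡false)
  where
  case : ∀ v → y′ v ≡ toggle y u v
  case v with v ≟ u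
  ... | yes refl = trans (¬-not differ) (xor-comm true (y v))
  ... | no  v≢u  = trans (agree v v≢u) (sym (xor-identityʳ (y v)))

module _ {N} {h : BF N} (h-cong : Congruent h) (∂h≡false : ∀ w y → ∂ h w y ≡ false) where

  private
    Supported : (Fin N → Bool) → List (Fin N) → Set
    Supported y ws = ∀ u → y u ≡ true → u ∈ ws

    supported-constant : ∀ ws y → Supported y ws → h y ≡ h (const false)
    supported-constant []       y supp = h-cong vanishes
      where
      vanishes : y ≗ const false
      vanishes u with y u in yu
      ... | true  with () ← supp u yu
      ... | false = refl
    supported-constant (w ∷ ws) y supp with y w in yw
    ... | false = supported-constant ws y supp′
      where
      supp′ : Supported y ws
      supp′ u yu with supp u yu
      ... | here refl = contradiction (trans (sym yu) yw) λ ()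
      ... | there u∈ws = u∈ws
    ... | true = trans (sym (xor≡false⇒≡ (∂h≡false w y))) (supported-constant ws (toggle y w) supp′)
      where
      supp′ : Supported (toggle y w) ws
      supp′ u tu with u ≟ w
      ... | yes refl rewrite yw = contradiction tu λ ()
      ... | no u≢w with supp u (trans (sym (xor-identityʳ (y u))) tu)
      ...   | here u≡w   = contradiction u≡w u≢w
      ...   | there u∈ws = u∈ws

  constant-if-∂≡false : ∀ y → h y ≡ h (const false)
  constant-if-∂≡false y = supported-constant (allFin N) y (λ u _ → ∈-allFin u)

unit : ∀ {N} → Fin N → Fin N → Bool
unit x u = does (u ≟ x)

record Varies {N} (h : BF N) (w : Fin N) : Set where
  constructor varies-at
  field
    witness : Fin N → Bool
    differs : ∂ h w witness ≢ ∂ h w (const false)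

record Essential {N} (h : BF N) (w : Fin N) : Set where
  constructor essential-at
  field
    witness : Fin N → Bool
    nonzero : ∂ h w witness ≡ true

varies⇒essential : ∀ {N} {h : BF N} {w} → Varies h w → Essential h w
varies⇒essential {h = h} {w} (varies-at a a≢0) with ∂ h w a in ∂a | ∂ h w (const false) in ∂0
... | true  | _     = essential-at a ∂a
... | false | true  = essential-at (const false) ∂0
... | false | false = contradiction refl a≢0

¬varies-if-constant : ∀ {N} {h : BF N} {w b} → (∀ a → ∂ h w a ≡ b) → ¬ Varies h w
¬varies-if-constant constant (varies-at a a≢0) =
  a≢0 (trans (constant a) (sym (constant (const false))))

-- Minors along maps of variables

minor : ∀ {M N} → BF N → (Fin N → Fin M) → BF M
minor h ρ a = h (a ∘ ρ)

module _ {M N} {h : BF N} (h-cong : Congruent h) (ρ : Fin N → Fin M) where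

  ∂-minor-outside : ∀ {w} → (∀ p → ρ p ≢ w) → ∀ a → ∂ (minor h ρ) w a ≡ false
  ∂-minor-outside {w} w∉ρ a = trans (cong (_xor h (a ∘ ρ)) (h-cong unchanged)) (xor-same (h (a ∘ ρ)))
    where
    unchanged : toggle a w ∘ ρ ≗ a ∘ ρ
    unchanged u = trans (cong (a (ρ u) xor_) (dec-false (ρ u ≟ w) (w∉ρ u))) (xor-identityʳ (a (ρ u)))

  ∂-minor-single : ∀ {p} → (∀ u → ρ u ≡ ρ p → u ≡ p) → ∀ a → ∂ (minor h ρ) (ρ p) a ≡ ∂ h p (a ∘ ρ)
  ∂-minor-single {p} fibre a = cong (_xor h (a ∘ ρ)) (h-cong (λ u → cong (a (ρ u) xor_) (hit u)))
    where
    hit : ∀ u → does (ρ u ≟ ρ p) ≡ does (u ≟ p)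
    hit u with u ≟ p
    ... | yes refl = dec-true (ρ u ≟ ρ u) refl
    ... | no u≢p   = dec-false (ρ u ≟ ρ p) (u≢p ∘ fibre u)

  ∂-minor-pair : ∀ {i j} → i ≢ j → (∀ u → ρ u ≡ ρ i → u ≡ i ⊎ u ≡ j) →
                 ρ i ≡ ρ j → ∀ a → ∂ (minor h ρ) (ρ i) a ≡ ∂₂ h i j (a ∘ ρ)
  ∂-minor-pair {i} {j} i≢j fibre ρi≡ρj a = cong (_xor h (a ∘ ρ)) (h-cong (λ u →
    trans (cong (a (ρ u) xor_) (hit u)) (sym (xor-assoc (a (ρ u)) (does (u ≟ i)) (does (u ≟ j))))))
    where
    hit : ∀ u → does (ρ u ≟ ρ i) ≡ does (u ≟ i) xor does (u ≟ j)
    hit u with u ≟ i | u ≟ j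
    ... | yes refl | yes refl = contradiction refl i≢j
    ... | yes refl | no _     = dec-true (ρ u ≟ ρ u) refl
    ... | no _     | yes refl = dec-true (ρ u ≟ ρ i) (sym ρi≡ρj)
    ... | no u≢i   | no u≢j   = dec-false (ρ u ≟ ρ i) (λ e → [ u≢i , u≢j ]′ (fibre u e))

-- The Boolean function of a graph

∑-δ : ∀ {N} (w : Fin N) (g : Fin N → Bool) → ∑[ u < N ] (does (u ≟ w) ∧ g u) ≡ g w
∑-δ {suc N} zero    g = trans (cong (g zero xor_) (sum-replicate-zero N)) (xor-identityʳ (g zero))
∑-δ {suc N} (suc w) g = ∑-δ {N} w (λ u → g (suc u))

∑∑-distrib : ∀ {N} (f g : Fin N → Fin N → Bool) →
  ∑[ i < N ] ∑[ j < N ] (f i j xor g i j) ≡ (∑[ i < N ] ∑[ j < N ] f i j) xor (∑[ i < N ] ∑[ j < N ] g i j)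
∑∑-distrib {N} f g = trans (sum-cong-≗ (λ i → ∑-distrib-+ (f i) (g i)))
                           (∑-distrib-+ (λ i → ∑[ j < N ] f i j) (λ i → ∑[ j < N ] g i j))

∑∑-δ-outer : ∀ {N} (w : Fin N) (g : Fin N → Fin N → Bool) →
  ∑[ i < N ] ∑[ j < N ] (does (i ≟ w) ∧ g i j) ≡ ∑[ j < N ] g w j
∑∑-δ-outer {N} w g =
  trans (sum-cong-≗ (λ i → sym (*-distribˡ-sum (does (i ≟ w)) (g i)))) (∑-δ w (λ i → ∑[ j < N ] g i j))

xorSum-++ : ∀ xs ys → xorSum (xs ++ ys) ≡ xorSum xs xor xorSum ys
xorSum-++ []       ys = refl
xorSum-++ (x ∷ xs) ys = trans (cong (x xor_) (xorSum-++ xs ys)) (sym (xor-assoc x _ _))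

xorSum-concatMap : ∀ {A : Set} (f : A → List Bool) xs →
  xorSum (concatMap f xs) ≡ xorSum (map (xorSum ∘ f) xs)
xorSum-concatMap f []       = refl
xorSum-concatMap f (x ∷ xs) =
  trans (xorSum-++ (f x) _) (cong (xorSum (f x) xor_) (xorSum-concatMap f xs))

xorSum-filter : ∀ {A : Set} {P : Pred A 0ℓ} (P? : Decidable P) (h : A → Bool) xs →
  xorSum (map h (filter P? xs)) ≡ xorSum (map (λ x → does (P? x) ∧ h x) xs)
xorSum-filter P? h []       = refl
xorSum-filter P? h (x ∷ xs) with does (P? x)
... | true  = cong (h x xor_) (xorSum-filter P? h xs)
... | false = xorSum-filter P? h xs

xorSum-tabulate : ∀ {A : Set} {N} (h : A → Bool) (f : Fin N → A) →
  xorSum (map h (tabulate f)) ≡ ∑[ i < N ] h (f i)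
xorSum-tabulate {N = zero}  h f = refl
xorSum-tabulate {N = suc N} h f = cong (h (f zero) xor_) (xorSum-tabulate h (f ∘ suc))

linear : ∀ {N} → (Fin N → Bool) → (Fin N → Bool) → Bool
linear {N} l x = ∑[ i < N ] (l i ∧ x i)

quadratic : ∀ {N} → (Fin N → Fin N → Bool) → (Fin N → Bool) → Bool
quadratic {N} c x = ∑[ i < N ] ∑[ j < N ] (c i j ∧ (x i ∧ x j))

upperAdj : ∀ {N} → Graph N → Fin N → Fin N → Bool
upperAdj G i j = does (i <? j) ∧ adj G i j

fG-normal : ∀ {N} (G : Graph N) x → fG G x ≡ linear (loop G) x xor quadratic (upperAdj G) x
fG-normal {N} G x = cong₂ _xor_ (xorSum-tabulate (λ i → loop G i ∧ x i) (λ i → i)) (begin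
  xorSum (concatMap row (allFin N))        ≡⟨ xorSum-concatMap row (allFin N) ⟩
  xorSum (map (xorSum ∘ row) (allFin N))   ≡⟨ xorSum-tabulate (xorSum ∘ row) (λ i → i) ⟩
  ∑[ i < N ] xorSum (row i)                 ≡⟨ sum-cong-≗ (λ i → rowSum i) ⟩
  quadratic (upperAdj G) x                  ∎)
  where
  open ≡-Reasoning
  row : Fin N → List Bool
  row i = map (λ j → adj G i j ∧ (x i ∧ x j)) (filter (λ j → i <? j) (allFin N))
  rowSum : ∀ i → xorSum (row i) ≡ ∑[ j < N ] (upperAdj G i j ∧ (x i ∧ x j))
  rowSum i = begin
    xorSum (row i)
      ≡⟨ xorSum-filter (λ j → i <? j) (λ j → adj G i j ∧ (x i ∧ x j)) (allFin N) ⟩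
    xorSum (map (λ j → does (i <? j) ∧ (adj G i j ∧ (x i ∧ x j))) (allFin N))
      ≡⟨ xorSum-tabulate (λ j → does (i <? j) ∧ (adj G i j ∧ (x i ∧ x j))) (λ j → j) ⟩
    ∑[ j < N ] (does (i <? j) ∧ (adj G i j ∧ (x i ∧ x j)))
      ≡⟨ sum-cong-≗ (λ j → sym (∧-assoc (does (i <? j)) (adj G i j) (x i ∧ x j))) ⟩
    ∑[ j < N ] (upperAdj G i j ∧ (x i ∧ x j)) ∎

fG-cong : ∀ {N} (G : Graph N) → Congruent (fG G)
fG-cong G {x} {y} x≗y = trans (fG-normal G x) (trans (cong₂ _xor_
  (sum-cong-≗ (λ i → cong (loop G i ∧_) (x≗y i)))
  (sum-cong-≗ (λ i → sum-cong-≗ (λ j → cong (upperAdj G i j ∧_) (cong₂ _∧_ (x≗y i) (x≗y j))))))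
  (sym (fG-normal G y)))

linear-toggle : ∀ {N} (l x : Fin N → Bool) w → linear l (toggle x w) ≡ linear l x xor l w
linear-toggle {N} l x w = begin
  ∑[ i < N ] (l i ∧ (x i xor does (i ≟ w)))
    ≡⟨ sum-cong-≗ (λ i → ∧-distribˡ-xor (l i) (x i) (does (i ≟ w))) ⟩
  ∑[ i < N ] ((l i ∧ x i) xor (l i ∧ does (i ≟ w)))
    ≡⟨ ∑-distrib-+ (λ i → l i ∧ x i) (λ i → l i ∧ does (i ≟ w)) ⟩
  linear l x xor ∑[ i < N ] (l i ∧ does (i ≟ w))
    ≡⟨ cong (linear l x xor_) (trans (sum-cong-≗ (λ i → ∧-comm (l i) (does (i ≟ w)))) (∑-δ w l)) ⟩
  linear l x xor l w ∎
  where open ≡-Reasoning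

quadratic-toggle : ∀ {N} (c : Fin N → Fin N → Bool) x w → c w w ≡ false →
  quadratic c (toggle x w) ≡ quadratic c x xor ∑[ u < N ] ((c w u xor c u w) ∧ x u)
quadratic-toggle {N} c x w cww≡false = begin
  quadratic c (toggle x w)
    ≡⟨ sum-cong-≗ (λ i → sum-cong-≗ (λ j → expand (c i j) (x i) (x j) (δ i) (δ j))) ⟩
  ∑∑ (λ i j → (c i j ∧ (x i ∧ x j)) xor (firstOrder i j xor diag i j))
    ≡⟨ trans (∑∑-distrib (λ i j → c i j ∧ (x i ∧ x j)) (λ i j → firstOrder i j xor diag i j))
             (cong (quadratic c x xor_) (∑∑-distrib firstOrder diag)) ⟩
  quadratic c x xor (∑∑ firstOrder xor ∑∑ diag)
    ≡⟨ cong₂ (λ a b → quadratic c x xor (a xor b)) firstOrder-sum diagonal ⟩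
  quadratic c x xor (∑[ u < N ] ((c w u xor c u w) ∧ x u) xor false)
    ≡⟨ cong (quadratic c x xor_) (xor-identityʳ _) ⟩
  quadratic c x xor ∑[ u < N ] ((c w u xor c u w) ∧ x u) ∎
  where
  open ≡-Reasoning
  δ : Fin N → Bool
  δ u = does (u ≟ w)
  ∑∑ : (Fin N → Fin N → Bool) → Bool
  ∑∑ f = ∑[ i < N ] ∑[ j < N ] f i j
  expand : ∀ c a b d e → c ∧ ((a xor d) ∧ (b xor e)) ≡
           (c ∧ (a ∧ b)) xor (((d ∧ (c ∧ b)) xor (e ∧ (c ∧ a))) xor (d ∧ (e ∧ c)))
  expand = solve-∀ boolRing
  firstOrder : Fin N → Fin N → Bool
  firstOrder i j = (δ i ∧ (c i j ∧ x j)) xor (δ j ∧ (c i j ∧ x i))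
  firstOrder-sum : ∑∑ firstOrder ≡ ∑[ u < N ] ((c w u xor c u w) ∧ x u)
  firstOrder-sum = begin
    ∑∑ firstOrder
      ≡⟨ ∑∑-distrib (λ i j → δ i ∧ (c i j ∧ x j)) (λ i j → δ j ∧ (c i j ∧ x i)) ⟩
    ∑∑ (λ i j → δ i ∧ (c i j ∧ x j)) xor ∑∑ (λ i j → δ j ∧ (c i j ∧ x i))
      ≡⟨ cong₂ _xor_ (∑∑-δ-outer w (λ i j → c i j ∧ x j)) (sum-cong-≗ (λ i → ∑-δ w (λ j → c i j ∧ x i))) ⟩
    ∑[ u < N ] (c w u ∧ x u) xor ∑[ u < N ] (c u w ∧ x u)
      ≡⟨ sym (∑-distrib-+ (λ u → c w u ∧ x u) (λ u → c u w ∧ x u)) ⟩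
    ∑[ u < N ] ((c w u ∧ x u) xor (c u w ∧ x u))
      ≡⟨ sum-cong-≗ (λ u → sym (∧-distribʳ-xor (x u) (c w u) (c u w))) ⟩
    ∑[ u < N ] ((c w u xor c u w) ∧ x u) ∎
  diag : Fin N → Fin N → Bool
  diag i j = δ i ∧ (δ j ∧ c i j)
  diagonal : ∑∑ diag ≡ false
  diagonal = trans (∑∑-δ-outer w (λ i j → δ j ∧ c i j)) (trans (∑-δ w (c w)) cww≡false)

upperAdj-symmetrised : ∀ {N} (G : Graph N) w u → upperAdj G w u xor upperAdj G u w ≡ adj G w u
upperAdj-symmetrised G w u with <-cmp w u
... | tri< w<u _ _
  rewrite dec-true (w <? u) w<u | dec-false (u <? w) (<-asym w<u) = xor-identityʳ (adj G w u)
... | tri≈ _ refl _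
  rewrite dec-false (w <? w) (<-irrefl refl) | adj-irr G w = refl
... | tri> _ _ u<w
  rewrite dec-false (w <? u) (<-asym u<w) | dec-true (u <? w) u<w = adj-sym G u w

fG-∂ : ∀ {N} (G : Graph N) w y → ∂ (fG G) w y ≡ loop G w xor ∑[ u < N ] (adj G w u ∧ y u)
fG-∂ {N} G w y = begin
  fG G (toggle y w) xor fG G y
    ≡⟨ cong₂ _xor_ (fG-normal G (toggle y w)) (fG-normal G y) ⟩
  (linear l (toggle y w) xor quadratic c (toggle y w)) xor (linear l y xor quadratic c y)
    ≡⟨ cong₂ (λ a b → (a xor b) xor (linear l y xor quadratic c y))
             (linear-toggle l y w) (quadratic-toggle c y w c-diagonal) ⟩
  ((linear l y xor l w) xor (quadratic c y xor S)) xor (linear l y xor quadratic c y)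
    ≡⟨ cancel (linear l y) (l w) (quadratic c y) S ⟩
  l w xor S
    ≡⟨ cong (l w xor_) (sum-cong-≗ (λ u → cong (_∧ y u) (upperAdj-symmetrised G w u))) ⟩
  loop G w xor ∑[ u < N ] (adj G w u ∧ y u) ∎
  where
  open ≡-Reasoning
  l : Fin N → Bool
  l = loop G
  c : Fin N → Fin N → Bool
  c = upperAdj G
  c-diagonal : c w w ≡ false
  c-diagonal = cong (_∧ adj G w w) (dec-false (w <? w) (<-irrefl refl))
  S : Bool
  S = ∑[ u < N ] ((c w u xor c u w) ∧ y u)
  cancel : ∀ L a Q b → ((L xor a) xor (Q xor b)) xor (L xor Q) ≡ a xor b
  cancel = solve-∀ boolRing

fG-∂-zero : ∀ {N} (G : Graph N) w → ∂ (fG G) w (const false) ≡ loop G w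
fG-∂-zero {N} G w = trans (fG-∂ G w (const false))
  (trans (cong (loop G w xor_) (trans (sum-cong-≗ (λ u → ∧-zeroʳ (adj G w u))) (sum-replicate-zero N)))
         (xor-identityʳ (loop G w)))

fG-∂-unit : ∀ {N} (G : Graph N) w x → ∂ (fG G) w (unit x) ≡ loop G w xor adj G w x
fG-∂-unit {N} G w x = trans (fG-∂ G w (unit x))
  (cong (loop G w xor_) (trans (sum-cong-≗ (λ u → ∧-comm (adj G w u) (does (u ≟ x)))) (∑-δ x (adj G w))))

fG-∂-toggle : ∀ {N} (G : Graph N) w y x → ∂ (fG G) w (toggle y x) ≡ ∂ (fG G) w y xor adj G w x
fG-∂-toggle {N} G w y x = begin
  ∂ (fG G) w (toggle y x)
    ≡⟨ fG-∂ G w (toggle y x) ⟩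
  loop G w xor ∑[ u < N ] (adj G w u ∧ (y u xor does (u ≟ x)))
    ≡⟨ cong (loop G w xor_) (trans (sum-cong-≗ (λ u → ∧-distribˡ-xor (adj G w u) (y u) (does (u ≟ x))))
         (∑-distrib-+ (λ u → adj G w u ∧ y u) (λ u → adj G w u ∧ does (u ≟ x)))) ⟩
  loop G w xor (∑[ u < N ] (adj G w u ∧ y u) xor ∑[ u < N ] (adj G w u ∧ does (u ≟ x)))
    ≡⟨ cong (λ b → loop G w xor (∑[ u < N ] (adj G w u ∧ y u) xor b))
            (trans (sum-cong-≗ (λ u → ∧-comm (adj G w u) (does (u ≟ x)))) (∑-δ x (adj G w))) ⟩
  loop G w xor (∑[ u < N ] (adj G w u ∧ y u) xor adj G w x)
    ≡⟨ sym (xor-assoc (loop G w) _ _) ⟩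
  (loop G w xor ∑[ u < N ] (adj G w u ∧ y u)) xor adj G w x
    ≡⟨ cong (_xor adj G w x) (sym (fG-∂ G w y)) ⟩
  ∂ (fG G) w y xor adj G w x ∎
  where open ≡-Reasoning

fG-∂₂ : ∀ {N} (G : Graph N) i j y →
        ∂₂ (fG G) i j y ≡ (∂ (fG G) j y xor adj G j i) xor ∂ (fG G) i y
fG-∂₂ G i j y = trans (∂₂-split (fG G) i j y) (cong (_xor ∂ (fG G) i y) (fG-∂-toggle G j y i))

-- Maps between finite sets that identify exactly two points

covers-injection⇒≤ : ∀ {A B C} (g : Fin A → Fin C) (e : Fin B → Fin C) → Injective _≡_ _≡_ e →
                     (∀ b → ∃ λ a → g a ≡ e b) → B ℕ.≤ A
covers-injection⇒≤ g e e-injective covers = injective⇒≤ section-injective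
  where
  section-injective : Injective _≡_ _≡_ (proj₁ ∘ covers)
  section-injective {b} {b′} eq =
    e-injective (trans (sym (proj₂ (covers b))) (trans (cong g eq) (proj₂ (covers b′))))

covering-injective : ∀ {A C} (g : Fin A → Fin C) (e : Fin A → Fin C) → Injective _≡_ _≡_ e →
                     (∀ b → ∃ λ a → g a ≡ e b) → Injective _≡_ _≡_ g
covering-injective {suc A} g e e-injective covers {x} {y} gx≡gy with x ≟ y
... | yes x≡y = x≡y
... | no  x≢y = contradiction (covers-injection⇒≤ (g ∘ punchIn y) e e-injective covers′) 1+n≰n
  where
  covers′ : ∀ b → ∃ λ a → g (punchIn y a) ≡ e b
  covers′ b with covers b
  ... | p , gp with p ≟ y
  ...   | yes refl = punchOut (x≢y ∘ sym) ,
                     trans (cong g (punchIn-punchOut (x≢y ∘ sym))) (trans gx≡gy gp)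
  ...   | no  p≢y  = punchOut (p≢y ∘ sym) , trans (cong g (punchIn-punchOut (p≢y ∘ sym))) gp

collision⇒misses : ∀ {N} (ρ : Fin N → Fin N) {i j} → i ≢ j → ρ i ≡ ρ j → ∃ λ w → ∀ p → ρ p ≢ w
collision⇒misses ρ i≢j ρi≡ρj with any? (λ w → all? (λ p → ¬? (ρ p ≟ w)))
... | yes missed = missed
... | no  ¬missed = contradiction (covering-injective ρ (λ w → w) (λ eq → eq) covers ρi≡ρj) i≢j
  where
  covers : ∀ w → ∃ λ p → ρ p ≡ w
  covers w with any? (λ p → ρ p ≟ w)
  ... | yes hit = hit
  ... | no  ¬hit = contradiction (w , λ p eq → ¬hit (p , eq)) ¬missed

one-of-three-avoids : ∀ {A : Set} {P : A → Set} → DecidableEquality A → ∀ {a b c} → P a → P b → P c →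
                      a ≢ b → a ≢ c → b ≢ c → ∀ x y → ∃ λ z → P z × z ≢ x × z ≢ y
one-of-three-avoids _≟ₐ_ {a} {b} {c} pa pb pc a≢b a≢c b≢c x y with a ≟ₐ x | a ≟ₐ y
... | no a≢x | no a≢y = a , pa , a≢x , a≢y
... | yes refl | _ with b ≟ₐ y
...   | no  b≢y  = b , pb , a≢b ∘ sym , b≢y
...   | yes refl = c , pc , a≢c ∘ sym , b≢c ∘ sym
one-of-three-avoids _≟ₐ_ {a} {b} {c} pa pb pc a≢b a≢c b≢c x y | no _ | yes refl with b ≟ₐ x
...   | no  b≢x  = b , pb , b≢x , a≢b ∘ sym
...   | yes refl = c , pc , b≢c ∘ sym , a≢c ∘ sym

record Collapse {N} (ρ : Fin N → Fin N) (i j : Fin N) : Set where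
  field
    distinct      : i ≢ j
    glued         : ρ i ≡ ρ j
    injective-off : ∀ {u v} → u ≢ j → v ≢ j → ρ u ≡ ρ v → u ≡ v

  fibre-pair : ∀ u → ρ u ≡ ρ i → u ≡ i ⊎ u ≡ j
  fibre-pair u ρu≡ρi with u ≟ j
  ... | yes u≡j = inj₂ u≡j
  ... | no  u≢j = inj₁ (injective-off u≢j distinct ρu≡ρi)

  fibre-single : ∀ {p} → p ≢ i → p ≢ j → ∀ u → ρ u ≡ ρ p → u ≡ p
  fibre-single {p} p≢i p≢j u ρu≡ρp with u ≟ j
  ... | yes refl = contradiction (injective-off distinct p≢j (trans glued ρu≡ρp)) (p≢i ∘ sym)
  ... | no  u≢j  = injective-off u≢j p≢j ρu≡ρp

collapse-if-covers : ∀ {N} (ρ : Fin N → Fin N) {i j l} → i ≢ j → ρ i ≡ ρ j →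
                     (∀ w → w ≢ l → ∃ λ p → ρ p ≡ w) → Collapse ρ i j × (∀ p → ρ p ≢ l)
collapse-if-covers {suc K} ρ {i} {j} {l} i≢j ρi≡ρj covers =
  record { distinct = i≢j ; glued = ρi≡ρj ; injective-off = injective-off } , misses-l
  where
  restricted-covers : ∀ b → ∃ λ a → ρ (punchIn j a) ≡ punchIn l b
  restricted-covers b with covers (punchIn l b) (punchInᵢ≢i l b)
  ... | p , ρp with p ≟ j
  ...   | yes refl = punchOut (i≢j ∘ sym) ,
                     trans (cong ρ (punchIn-punchOut (i≢j ∘ sym))) (trans ρi≡ρj ρp)
  ...   | no  p≢j  = punchOut (p≢j ∘ sym) , trans (cong ρ (punchIn-punchOut (p≢j ∘ sym))) ρp
  restricted-injective : Injective _≡_ _≡_ (ρ ∘ punchIn j)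
  restricted-injective =
    covering-injective (ρ ∘ punchIn j) (punchIn l) (punchIn-injective l _ _) restricted-covers
  injective-off : ∀ {u v} → u ≢ j → v ≢ j → ρ u ≡ ρ v → u ≡ v
  injective-off {u} {v} u≢j v≢j ρu≡ρv = begin
    u                                ≡⟨ punchIn-punchOut (u≢j ∘ sym) ⟨
    punchIn j (punchOut (u≢j ∘ sym)) ≡⟨ cong (punchIn j) (restricted-injective (begin
      ρ (punchIn j (punchOut (u≢j ∘ sym))) ≡⟨ cong ρ (punchIn-punchOut (u≢j ∘ sym)) ⟩
      ρ u                                  ≡⟨ ρu≡ρv ⟩
      ρ v                                  ≡⟨ cong ρ (punchIn-punchOut (v≢j ∘ sym)) ⟨
      ρ (punchIn j (punchOut (v≢j ∘ sym))) ∎)) ⟩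
    punchIn j (punchOut (v≢j ∘ sym)) ≡⟨ punchIn-punchOut (v≢j ∘ sym) ⟩
    v                                ∎
    where open ≡-Reasoning
  misses-l : ∀ p → ρ p ≢ l
  misses-l p ρp≡l = i≢j (covering-injective ρ (λ w → w) (λ eq → eq) covers-all ρi≡ρj)
    where
    covers-all : ∀ w → ∃ λ q → ρ q ≡ w
    covers-all w with w ≟ l
    ... | yes refl = p , ρp≡l
    ... | no  w≢l  = covers w w≢l

essential⇒in-image : ∀ {N} {h : BF N} → Congruent h → (σ ρ : Fin N → Fin N) →
                     minor h σ ≗ minor h ρ → ∀ {w} → Essential (minor h σ) w → ∃ λ p → ρ p ≡ w
essential⇒in-image h-cong σ ρ agree {w} (essential-at a ∂≡true) with any? (λ p → ρ p ≟ w)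
... | yes hit = hit
... | no ¬hit = contradiction
      (trans (sym ∂≡true) (trans (∂-cong agree w a) (∂-minor-outside h-cong ρ (λ p eq → ¬hit (p , eq)) a)))
      λ ()

collapse-if-minors-agree : ∀ {N} {h : BF N} → Congruent h → (σ ρ : Fin N → Fin N) → ∀ {i j l} →
  minor h σ ≗ minor h ρ → (∀ w → w ≢ l → Essential (minor h σ) w) → i ≢ j → ρ i ≡ ρ j →
  Collapse ρ i j × (∀ p → ρ p ≢ l)
collapse-if-minors-agree h-cong σ ρ agree essential i≢j ρi≡ρj =
  collapse-if-covers ρ i≢j ρi≡ρj (λ w w≢l → essential⇒in-image h-cong σ ρ agree (essential w w≢l))

identify : ∀ {N} → Fin N → Fin N → Fin N → Fin N
identify k l u with u ≟ l
... | yes _ = k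
... | no  _ = u

identify-fixes : ∀ {N} (k : Fin N) {l u} → u ≢ l → identify k l u ≡ u
identify-fixes k {l} {u} u≢l with u ≟ l
... | yes u≡l = contradiction u≡l u≢l
... | no  _   = refl

identify-l : ∀ {N} (k l : Fin N) → identify k l l ≡ k
identify-l k l with l ≟ l
... | yes _   = refl
... | no  l≢l = contradiction refl l≢l

identify-≢ : ∀ {N} {k l u m : Fin N} → k ≢ m → u ≢ m → identify k l u ≢ m
identify-≢ {l = l} {u} k≢m u≢m with u ≟ l
... | yes _ = k≢m
... | no  _ = u≢m

identify-∘-swap : ∀ {N} {k l : Fin N} → k ≢ l → ∀ u → identify k l (identify l k u) ≡ identify k l u
identify-∘-swap {k = k} {l} k≢l u with u ≟ k
... | yes refl = trans (identify-l u l) (sym (identify-fixes u k≢l))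
... | no  _    = refl

identify-invisible : ∀ {N M} {σ : Fin N → Fin M} {i j} → σ i ≡ σ j → ∀ u → σ (identify i j u) ≡ σ u
identify-invisible {j = j} σi≡σj u with u ≟ j
... | yes refl = σi≡σj
... | no  _    = refl

identify-commutes : ∀ {N} {ψ : Fin N → Fin N} → Injective _≡_ _≡_ ψ →
                    ∀ x y u → identify (ψ x) (ψ y) (ψ u) ≡ ψ (identify x y u)
identify-commutes {ψ = ψ} ψ-injective x y u with u ≟ y
... | yes refl = identify-l (ψ x) (ψ u)
... | no  u≢y  = identify-fixes (ψ x) (u≢y ∘ ψ-injective)

identify-collapse : ∀ {N} {k l : Fin N} → k ≢ l → Collapse (identify k l) k l
identify-collapse {k = k} {l} k≢l = record
  { distinct      = k≢l
  ; glued         = trans (identify-fixes k k≢l) (sym (identify-l k l))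
  ; injective-off = λ u≢l v≢l eq →
      trans (sym (identify-fixes k u≢l)) (trans eq (identify-fixes k v≢l))
  }

identify-swap-≼ : ∀ {N} {h : BF N} → Congruent h → ∀ {k l} → k ≢ l →
                  (N , minor h (identify k l)) ≼ (N , minor h (identify l k))
identify-swap-≼ h-cong k≢l = identify _ _ , λ a → h-cong (λ u → cong a (sym (identify-∘-swap k≢l u)))

≼-trans : ∀ {l m n} {f : BF l} {g : BF m} {h : BF n} →
          (l , f) ≼ (m , g) → (m , g) ≼ (n , h) → (l , f) ≼ (n , h)
≼-trans (σ , f≡g) (τ , g≡h) = σ ∘ τ , λ a → trans (f≡g a) (g≡h (a ∘ σ))

-- The vertex argument only serves as a default value of the left inverse of σ built in the proof.
collision-if-strictly-below : ∀ {M N} {g : BF M} {f : BF N} → Congruent f → Fin N → (M , g) ≺ (N , f) →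
                              ∃ λ σ → (∀ a → g a ≡ minor f σ a) × ∃₂ λ i j → i ≢ j × σ i ≡ σ j
collision-if-strictly-below {M} {N} {g} {f} f-cong default ((σ , g≡fσ) , f⋠g) = σ , g≡fσ , collision
  where
  collision : ∃₂ λ i j → i ≢ j × σ i ≡ σ j
  collision with any? (λ i → any? (λ j → ¬? (i ≟ j) ×-dec (σ i ≟ σ j)))
  ... | yes found = found
  ... | no  none  = contradiction (τ , f≡gτ) f⋠g
    where
    σ-injective : ∀ {i j} → σ i ≡ σ j → i ≡ j
    σ-injective {i} {j} eq with i ≟ j
    ... | yes i≡j = i≡j
    ... | no  i≢j = contradiction (i , j , i≢j , eq) none
    τ : Fin M → Fin N
    τ x with any? (λ p → σ p ≟ x)
    ... | yes (p , _) = p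
    ... | no  _       = default
    τ∘σ : ∀ u → τ (σ u) ≡ u
    τ∘σ u with any? (λ p → σ p ≟ σ u)
    ... | yes (p , σp≡σu) = σ-injective σp≡σu
    ... | no  ¬hit        = contradiction (u , refl) ¬hit
    f≡gτ : ∀ b → f b ≡ g (b ∘ τ)
    f≡gτ b = sym (trans (g≡fσ (b ∘ τ)) (f-cong (λ u → cong b (τ∘σ u))))

¬≗-collapsing-minor : ∀ {N} {h : BF N} → Congruent h → (∀ w → Varies h w) →
                      (ρ : Fin N → Fin N) → ∀ {i j} → i ≢ j → ρ i ≡ ρ j → ¬ (h ≗ minor h ρ)
¬≗-collapsing-minor {h = h} h-cong varies ρ i≢j ρi≡ρj h≗hρ with collision⇒misses ρ i≢j ρi≡ρj
... | w , w∉ρ with varies w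
...   | varies-at a a≢0 = a≢0 (trans (flat a) (sym (flat (const false))))
  where
  flat : ∀ b → ∂ h w b ≡ false
  flat b = trans (∂-cong h≗hρ w b) (∂-minor-outside h-cong ρ w∉ρ b)

-- Positions in a triangle, and permutations of the triangles

next : Fin 3 → Fin 3
next zero             = suc zero
next (suc zero)       = suc (suc zero)
next (suc (suc zero)) = zero

next³ : ∀ k → next (next (next k)) ≡ k
next³ zero             = refl
next³ (suc zero)       = refl
next³ (suc (suc zero)) = refl

next≢ : ∀ k → next k ≢ k
next≢ zero             ()
next≢ (suc zero)       ()
next≢ (suc (suc zero)) ()

next²≢ : ∀ k → next (next k) ≢ k
next²≢ zero             ()
next²≢ (suc zero)       ()
next²≢ (suc (suc zero)) ()

next-cover : ∀ p k → k ≡ p ⊎ k ≡ next p ⊎ k ≡ next (next p)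
next-cover zero             zero             = inj₁ refl
next-cover zero             (suc zero)       = inj₂ (inj₁ refl)
next-cover zero             (suc (suc zero)) = inj₂ (inj₂ refl)
next-cover (suc zero)       zero             = inj₂ (inj₂ refl)
next-cover (suc zero)       (suc zero)       = inj₁ refl
next-cover (suc zero)       (suc (suc zero)) = inj₂ (inj₁ refl)
next-cover (suc (suc zero)) zero             = inj₂ (inj₁ refl)
next-cover (suc (suc zero)) (suc zero)       = inj₂ (inj₂ refl)
next-cover (suc (suc zero)) (suc (suc zero)) = inj₁ refl

rotate : Fin 3 → Fin 3 → Fin 3
rotate zero             k = k
rotate (suc zero)       k = next k
rotate (suc (suc zero)) k = next (next k)

negate : Fin 3 → Fin 3
negate zero             = zero
negate (suc zero)       = suc (suc zero)
negate (suc (suc zero)) = suc zero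

rotate-next : ∀ d k → rotate d (next k) ≡ next (rotate d k)
rotate-next zero             k = refl
rotate-next (suc zero)       k = refl
rotate-next (suc (suc zero)) k = refl

rotate-zero : ∀ d → rotate d zero ≡ d
rotate-zero zero             = refl
rotate-zero (suc zero)       = refl
rotate-zero (suc (suc zero)) = refl

rotate-negate : ∀ d k → rotate (negate d) (rotate d k) ≡ k
rotate-negate zero             k = refl
rotate-negate (suc zero)       k = next³ k
rotate-negate (suc (suc zero)) k = next³ k

negate-rotate : ∀ d k → rotate d (rotate (negate d) k) ≡ k
negate-rotate zero             k = refl
negate-rotate (suc zero)       k = next³ k
negate-rotate (suc (suc zero)) k = next³ k

distinct-pair : ∀ {n} → n ≥ 2 → Σ (Fin n) λ a → Σ (Fin n) λ b → a ≢ b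
distinct-pair (s≤s (s≤s _)) = zero , suc zero , λ ()

another : ∀ {n} → n ≥ 2 → (t : Fin n) → ∃ λ t′ → t′ ≢ t
another (s≤s (s≤s _)) zero    = suc zero , λ ()
another (s≤s (s≤s _)) (suc t) = zero , λ ()

transpose-here : ∀ {n} (a b : Fin n) → PC.transpose a b a ≡ b
transpose-here a b rewrite dec-true (a ≟ a) refl = refl

transpose-other : ∀ {n} {a b c : Fin n} → c ≢ a → c ≢ b → PC.transpose a b c ≡ c
transpose-other {a = a} {b} {c} c≢a c≢b
  rewrite dec-false (c ≟ a) c≢a | dec-false (c ≟ b) c≢b = refl

permutation-sending : ∀ {n} {s t a b : Fin n} → s ≢ t → a ≢ b →
                      Σ (Permutation′ n) λ α → α ⟨$⟩ʳ s ≡ a × α ⟨$⟩ʳ t ≡ b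
permutation-sending {s = s} {t} {a} {b} s≢t a≢b =
  transpose s a ∘ₚ transpose t′ b , sends-s , transpose-here t′ b
  where
  t′ : Fin _
  t′ = PC.transpose s a t
  a≢t′ : a ≢ t′
  a≢t′ a≡t′ = s≢t (begin
    s
      ≡⟨ inverseˡ (transpose s a) ⟨
    transpose s a ⟨$⟩ˡ (transpose s a ⟨$⟩ʳ s)
      ≡⟨ cong (transpose s a ⟨$⟩ˡ_) (trans (transpose-here s a) a≡t′) ⟩
    transpose s a ⟨$⟩ˡ (transpose s a ⟨$⟩ʳ t)
      ≡⟨ inverseˡ (transpose s a) ⟩
    t ∎)
    where open ≡-Reasoning
  sends-s : PC.transpose t′ b (PC.transpose s a s) ≡ a
  sends-s rewrite transpose-here s a = transpose-other a≢t′ a≢b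

-- Graphs whose loopless part is a disjoint union of triangles

module Triangles {N n : ℕ} (n≥2 : n ≥ 2) (G : Graph N) (e : Fin N ↔ (Fin n × Fin 3))
  (adj⇔ : ∀ i j → (adj G i j ≡ true) ⇔ ((i ≢ j) × (proj₁ (Inverse.to e i) ≡ proj₁ (Inverse.to e j))))
  where

  F : BF N
  F = fG G

  F-cong : Congruent F
  F-cong = fG-cong G

  tri : Fin N → Fin n
  tri u = proj₁ (Inverse.to e u)

  pos : Fin N → Fin 3
  pos u = proj₂ (Inverse.to e u)

  vertex : Fin n → Fin 3 → Fin N
  vertex t k = Inverse.from e (t , k)

  tri-vertex : ∀ t k → tri (vertex t k) ≡ t
  tri-vertex t k = cong proj₁ (Inverse.strictlyInverseˡ e (t , k))

  pos-vertex : ∀ t k → pos (vertex t k) ≡ k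
  pos-vertex t k = cong proj₂ (Inverse.strictlyInverseˡ e (t , k))

  vertex-tri-pos : ∀ u → vertex (tri u) (pos u) ≡ u
  vertex-tri-pos = Inverse.strictlyInverseʳ e

  ≡-from-tri-pos : ∀ {u v} → tri u ≡ tri v → pos u ≡ pos v → u ≡ v
  ≡-from-tri-pos {u} {v} t p =
    trans (sym (vertex-tri-pos u)) (trans (cong₂ vertex t p) (vertex-tri-pos v))

  ≢-from-tri : ∀ {u v} → tri u ≢ tri v → u ≢ v
  ≢-from-tri far u≡v = far (cong tri u≡v)

  other-triangle : ∀ t → ∃ λ s → tri s ≢ t
  other-triangle t with another n≥2 t
  ... | t′ , t′≢t = vertex t′ zero , λ eq → t′≢t (trans (sym (tri-vertex t′ zero)) eq)

  t₀ t₁ : Fin n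
  t₀ = proj₁ (distinct-pair n≥2)
  t₁ = proj₁ (proj₂ (distinct-pair n≥2))

  t₀≢t₁ : t₀ ≢ t₁
  t₀≢t₁ = proj₂ (proj₂ (distinct-pair n≥2))

  p₀ q₀ : Fin N
  p₀ = vertex t₀ zero
  q₀ = vertex t₁ zero

  p₀≢q₀ : p₀ ≢ q₀
  p₀≢q₀ eq = t₀≢t₁ (trans (sym (tri-vertex t₀ zero)) (trans (cong tri eq) (tri-vertex t₁ zero)))

  merged : Fin N → Fin N → BF N
  merged k l = minor F (identify k l)

  cycle : Fin N → Fin N
  cycle u = vertex (tri u) (next (pos u))

  tri-cycle : ∀ u → tri (cycle u) ≡ tri u
  tri-cycle u = tri-vertex (tri u) (next (pos u))

  pos-cycle : ∀ u → pos (cycle u) ≡ next (pos u)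
  pos-cycle u = pos-vertex (tri u) (next (pos u))

  tri-cycle² : ∀ u → tri (cycle (cycle u)) ≡ tri u
  tri-cycle² u = trans (tri-cycle (cycle u)) (tri-cycle u)

  pos-cycle² : ∀ u → pos (cycle (cycle u)) ≡ next (next (pos u))
  pos-cycle² u = trans (pos-cycle (cycle u)) (cong next (pos-cycle u))

  cycle³ : ∀ u → cycle (cycle (cycle u)) ≡ u
  cycle³ u = ≡-from-tri-pos (trans (tri-cycle (cycle (cycle u))) (tri-cycle² u))
    (trans (pos-cycle (cycle (cycle u))) (trans (cong next (pos-cycle² u)) (next³ (pos u))))

  cycle≢ : ∀ u → cycle u ≢ u
  cycle≢ u eq = next≢ (pos u) (trans (sym (pos-cycle u)) (cong pos eq))

  cycle²≢ : ∀ u → cycle (cycle u) ≢ u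
  cycle²≢ u eq = next²≢ (pos u) (trans (sym (pos-cycle² u)) (cong pos eq))

  cycle-far : ∀ {u w} → tri u ≢ tri w → cycle u ≢ w
  cycle-far far eq = far (trans (sym (tri-cycle _)) (cong tri eq))

  cycle²-far : ∀ {u w} → tri u ≢ tri w → cycle (cycle u) ≢ w
  cycle²-far far eq = far (trans (sym (tri-cycle² _)) (cong tri eq))

  in-triangle : ∀ {u w} → tri u ≡ tri w → u ≡ w ⊎ u ≡ cycle w ⊎ u ≡ cycle (cycle w)
  in-triangle {u} {w} same with next-cover (pos w) (pos u)
  ... | inj₁ p        = inj₁ (≡-from-tri-pos same p)
  ... | inj₂ (inj₁ p) =
    inj₂ (inj₁ (≡-from-tri-pos (trans same (sym (tri-cycle w))) (trans p (sym (pos-cycle w)))))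
  ... | inj₂ (inj₂ p) =
    inj₂ (inj₂ (≡-from-tri-pos (trans same (sym (tri-cycle² w))) (trans p (sym (pos-cycle² w)))))

  adj-same-triangle : ∀ {w u} → w ≢ u → tri w ≡ tri u → adj G w u ≡ true
  adj-same-triangle {w} {u} w≢u same = Equivalence.from (adj⇔ w u) (w≢u , same)

  adj-other-triangle : ∀ {w u} → tri w ≢ tri u → adj G w u ≡ false
  adj-other-triangle {w} {u} far with adj G w u in a
  ... | true  = contradiction (proj₂ (Equivalence.to (adj⇔ w u) a)) far
  ... | false = refl

  adj-cycle : ∀ w → adj G w (cycle w) ≡ true
  adj-cycle w = adj-same-triangle (cycle≢ w ∘ sym) (sym (tri-cycle w))

  adj-cycle² : ∀ w → adj G w (cycle (cycle w)) ≡ true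
  adj-cycle² w = adj-same-triangle (cycle²≢ w ∘ sym) (sym (tri-cycle² w))

  adj-far-cycle : ∀ {u w} → tri u ≢ tri w → adj G w (cycle u) ≡ false
  adj-far-cycle {u} far = adj-other-triangle (λ eq → far (trans (sym (tri-cycle u)) (sym eq)))

  adj-far-cycle² : ∀ {u w} → tri u ≢ tri w → adj G w (cycle (cycle u)) ≡ false
  adj-far-cycle² {u} far = adj-other-triangle (λ eq → far (trans (sym (tri-cycle² u)) (sym eq)))

  adj-neighbours : ∀ w u → adj G w u ≡ does (u ≟ cycle w) xor does (u ≟ cycle (cycle w))
  adj-neighbours w u with u ≟ cycle w | u ≟ cycle (cycle w)
  ... | yes refl | yes eq = contradiction (sym eq) (cycle≢ (cycle w))
  ... | yes refl | no _   = adj-cycle w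
  ... | no _     | yes refl = adj-cycle² w
  ... | no u≢c   | no u≢c² with adj G w u in a
  ...   | false = refl
  ...   | true with Equivalence.to (adj⇔ w u) a
  ...     | w≢u , same with in-triangle (sym same)
  ...       | inj₁ u≡w        = contradiction (sym u≡w) w≢u
  ...       | inj₂ (inj₁ u≡c) = contradiction u≡c u≢c
  ...       | inj₂ (inj₂ u≡c²) = contradiction u≡c² u≢c²

  ∂F-neighbours : ∀ w y → ∂ F w y ≡ loop G w xor (y (cycle w) xor y (cycle (cycle w)))
  ∂F-neighbours w y = trans (fG-∂ G w y) (cong (loop G w xor_) (begin
    ∑[ u < N ] (adj G w u ∧ y u)
      ≡⟨ sum-cong-≗ (λ u → trans (cong (_∧ y u) (adj-neighbours w u))
                                 (∧-distribʳ-xor (y u) (does (u ≟ cycle w)) (does (u ≟ cycle (cycle w))))) ⟩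
    ∑[ u < N ] ((does (u ≟ cycle w) ∧ y u) xor (does (u ≟ cycle (cycle w)) ∧ y u))
      ≡⟨ ∑-distrib-+ (λ u → does (u ≟ cycle w) ∧ y u) (λ u → does (u ≟ cycle (cycle w)) ∧ y u) ⟩
    ∑[ u < N ] (does (u ≟ cycle w) ∧ y u) xor ∑[ u < N ] (does (u ≟ cycle (cycle w)) ∧ y u)
      ≡⟨ cong₂ _xor_ (∑-δ (cycle w) y) (∑-δ (cycle (cycle w)) y) ⟩
    y (cycle w) xor y (cycle (cycle w)) ∎))
    where open ≡-Reasoning

  ∂₂-cycle : ∀ i y →
             ∂₂ F i (cycle i) y ≡ (loop G i xor loop G (cycle i)) xor (true xor (y i xor y (cycle i)))
  ∂₂-cycle i y = begin
    ∂₂ F i (cycle i) y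
      ≡⟨ fG-∂₂ G i (cycle i) y ⟩
    (∂ F (cycle i) y xor adj G (cycle i) i) xor ∂ F i y
      ≡⟨ cong₂ (λ a b → (a xor b) xor ∂ F i y) (∂F-neighbours (cycle i) y)
               (trans (adj-sym G (cycle i) i) (adj-cycle i)) ⟩
    ((loop G (cycle i) xor (y (cycle (cycle i)) xor y (cycle (cycle (cycle i))))) xor true) xor ∂ F i y
      ≡⟨ cong₂ (λ a b → ((loop G (cycle i) xor (y (cycle (cycle i)) xor y a)) xor true) xor b)
               (cycle³ i) (∂F-neighbours i y) ⟩
    ((loop G (cycle i) xor (y (cycle (cycle i)) xor y i)) xor true) xor
      (loop G i xor (y (cycle i) xor y (cycle (cycle i))))
      ≡⟨ rearrange (loop G i) (loop G (cycle i)) (y i) (y (cycle i)) (y (cycle (cycle i))) true ⟩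
    (loop G i xor loop G (cycle i)) xor (true xor (y i xor y (cycle i))) ∎
    where
    open ≡-Reasoning
    rearrange : ∀ l l′ a b c t →
                ((l′ xor (c xor a)) xor t) xor (l xor (b xor c)) ≡ (l xor l′) xor (t xor (a xor b))
    rearrange = solve-∀ boolRing

  F-varies : ∀ w → Varies F w
  F-varies w = varies-at (unit (cycle w)) λ eq → xor-true≢ (loop G w) (begin
    loop G w xor true             ≡⟨ cong (loop G w xor_) (adj-cycle w) ⟨
    loop G w xor adj G w (cycle w) ≡⟨ fG-∂-unit G w (cycle w) ⟨
    ∂ F w (unit (cycle w))         ≡⟨ eq ⟩
    ∂ F w (const false)            ≡⟨ fG-∂-zero G w ⟩
    loop G w                       ∎)
    where open ≡-Reasoning

  merged-strictly-below : ∀ {k l} → k ≢ l → (N , merged k l) ≺ (N , F)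
  merged-strictly-below {k} {l} k≢l = (identify k l , λ a → refl) , λ { (σ , F≗) →
    ¬≗-collapsing-minor F-cong F-varies (σ ∘ identify k l) k≢l
                        (cong σ (Collapse.glued (identify-collapse k≢l))) F≗ }

  neighbour-avoiding : ∀ {i j} → tri i ≢ tri j → ∀ p → ∃ λ x → adj G p x ≡ true × x ≢ i × x ≢ j
  neighbour-avoiding {i} {j} far p with cycle p ≟ i | cycle p ≟ j
  ... | no c≢i | no c≢j = cycle p , adj-cycle p , c≢i , c≢j
  ... | yes refl | _    = cycle (cycle p) , adj-cycle² p , cycle≢ (cycle p) ,
                          cycle²-far (λ eq → far (trans (tri-cycle p) eq))
  ... | no _ | yes refl = cycle (cycle p) , adj-cycle² p ,
                          cycle²-far (λ eq → far (trans (sym eq) (sym (tri-cycle p)))) , cycle≢ (cycle p)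

  module CollapsedMinor {ρ : Fin N → Fin N} {i j : Fin N} (collapse : Collapse ρ i j) where
    open Collapse collapse

    pullback-unit : ∀ {x} → x ≢ i → x ≢ j → unit (ρ x) ∘ ρ ≗ unit x
    pullback-unit {x} x≢i x≢j u with u ≟ x
    ... | yes refl = dec-true (ρ u ≟ ρ u) refl
    ... | no  u≢x  = dec-false (ρ u ≟ ρ x) (u≢x ∘ fibre-single x≢i x≢j u)

    ∂-single : ∀ {p} → p ≢ i → p ≢ j → ∀ a → ∂ (minor F ρ) (ρ p) a ≡ ∂ F p (a ∘ ρ)
    ∂-single p≢i p≢j = ∂-minor-single F-cong ρ (fibre-single p≢i p≢j)

    ∂-centre : ∀ a → ∂ (minor F ρ) (ρ i) a ≡ ∂₂ F i j (a ∘ ρ)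
    ∂-centre = ∂-minor-pair F-cong ρ distinct fibre-pair glued

    varies-single : ∀ {p x} → p ≢ i → p ≢ j → x ≢ i → x ≢ j → adj G p x ≡ true →
                    Varies (minor F ρ) (ρ p)
    varies-single {p} {x} p≢i p≢j x≢i x≢j p~x =
      varies-at (unit (ρ x)) λ eq → xor-true≢ (loop G p) (begin
      loop G p xor true                 ≡⟨ cong (loop G p xor_) p~x ⟨
      loop G p xor adj G p x            ≡⟨ fG-∂-unit G p x ⟨
      ∂ F p (unit x)                    ≡⟨ ∂-respects F-cong p (pullback-unit x≢i x≢j) ⟨
      ∂ F p (unit (ρ x) ∘ ρ)            ≡⟨ ∂-single p≢i p≢j (unit (ρ x)) ⟨
      ∂ (minor F ρ) (ρ p) (unit (ρ x))  ≡⟨ eq ⟩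
      ∂ (minor F ρ) (ρ p) (const false) ≡⟨ ∂-single p≢i p≢j (const false) ⟩
      ∂ F p (const false)               ≡⟨ fG-∂-zero G p ⟩
      loop G p                          ∎)
      where open ≡-Reasoning

    ∂-single-unit : ∀ {p c} → p ≢ i → p ≢ j → c ≢ ρ (cycle p) → c ≢ ρ (cycle (cycle p)) →
                    ∂ (minor F ρ) (ρ p) (unit c) ≡ ∂ (minor F ρ) (ρ p) (const false)
    ∂-single-unit {p} {c} p≢i p≢j c≢ c≢′ = begin
      ∂ (minor F ρ) (ρ p) (unit c)
        ≡⟨ trans (∂-single p≢i p≢j (unit c)) (∂F-neighbours p (unit c ∘ ρ)) ⟩
      loop G p xor (does (ρ (cycle p) ≟ c) xor does (ρ (cycle (cycle p)) ≟ c))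
        ≡⟨ cong₂ (λ a b → loop G p xor (a xor b)) (dec-false (ρ (cycle p) ≟ c) (c≢ ∘ sym))
                                                  (dec-false (ρ (cycle (cycle p)) ≟ c) (c≢′ ∘ sym)) ⟩
      loop G p xor (false xor false)
        ≡⟨ trans (∂-single p≢i p≢j (const false)) (∂F-neighbours p (const false)) ⟨
      ∂ (minor F ρ) (ρ p) (const false) ∎
      where open ≡-Reasoning

    ∂-centre-zero : ∂ (minor F ρ) (ρ i) (const false) ≡ (loop G j xor adj G j i) xor loop G i
    ∂-centre-zero = trans (∂-centre (const false)) (trans (fG-∂₂ G i j (const false))
      (cong₂ (λ a b → (a xor adj G j i) xor b) (fG-∂-zero G j) (fG-∂-zero G i)))

    ∂-centre-unit : ∀ {x} → x ≢ i → x ≢ j → ∂ (minor F ρ) (ρ i) (unit (ρ x)) ≡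
                    ∂ (minor F ρ) (ρ i) (const false) xor (adj G i x xor adj G j x)
    ∂-centre-unit {x} x≢i x≢j = begin
      ∂ (minor F ρ) (ρ i) (unit (ρ x))
        ≡⟨ ∂-centre (unit (ρ x)) ⟩
      ∂₂ F i j (unit (ρ x) ∘ ρ)
        ≡⟨ ∂₂-respects F-cong i j (pullback-unit x≢i x≢j) ⟩
      ∂₂ F i j (unit x)
        ≡⟨ fG-∂₂ G i j (unit x) ⟩
      (∂ F j (unit x) xor adj G j i) xor ∂ F i (unit x)
        ≡⟨ cong₂ (λ a b → (a xor adj G j i) xor b) (fG-∂-unit G j x) (fG-∂-unit G i x) ⟩
      ((loop G j xor adj G j x) xor adj G j i) xor (loop G i xor adj G i x)
        ≡⟨ rearrange (loop G i) (loop G j) (adj G j i) (adj G i x) (adj G j x) ⟩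
      ((loop G j xor adj G j i) xor loop G i) xor (adj G i x xor adj G j x)
        ≡⟨ cong (_xor (adj G i x xor adj G j x)) ∂-centre-zero ⟨
      ∂ (minor F ρ) (ρ i) (const false) xor (adj G i x xor adj G j x) ∎
      where
      open ≡-Reasoning
      rearrange : ∀ l l′ a b c → ((l′ xor c) xor a) xor (l xor b) ≡ ((l′ xor a) xor l) xor (b xor c)
      rearrange = solve-∀ boolRing

    ∂-centre-cycle : j ≡ cycle i → ∀ a → ∂ (minor F ρ) (ρ i) a ≡ (loop G i xor loop G j) xor true
    ∂-centre-cycle refl a = begin
      ∂ (minor F ρ) (ρ i) a
        ≡⟨ trans (∂-centre a) (∂₂-cycle i (a ∘ ρ)) ⟩
      (loop G i xor loop G j) xor (true xor (a (ρ i) xor a (ρ j)))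
        ≡⟨ cong (λ b → (loop G i xor loop G j) xor (true xor (a (ρ i) xor b))) (cong a (sym glued)) ⟩
      (loop G i xor loop G j) xor (true xor (a (ρ i) xor a (ρ i)))
        ≡⟨ cong (λ b → (loop G i xor loop G j) xor (true xor b)) (xor-same (a (ρ i))) ⟩
      (loop G i xor loop G j) xor true ∎
      where open ≡-Reasoning

    module AcrossTriangles (far : tri i ≢ tri j) where

      ∂-centre-zero-loops : ∂ (minor F ρ) (ρ i) (const false) ≡ loop G i xor loop G j
      ∂-centre-zero-loops = begin
        ∂ (minor F ρ) (ρ i) (const false)     ≡⟨ ∂-centre-zero ⟩
        (loop G j xor adj G j i) xor loop G i ≡⟨ cong (λ a → (loop G j xor a) xor loop G i)
                                                        (adj-other-triangle (far ∘ sym)) ⟩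
        (loop G j xor false) xor loop G i     ≡⟨ cong (_xor loop G i) (xor-identityʳ (loop G j)) ⟩
        loop G j xor loop G i                 ≡⟨ xor-comm (loop G j) (loop G i) ⟩
        loop G i xor loop G j                 ∎
        where open ≡-Reasoning

      centre-flips : ∀ {x} → x ≢ i → x ≢ j → adj G i x xor adj G j x ≡ true →
                     ∂ (minor F ρ) (ρ i) (unit (ρ x)) ≢ ∂ (minor F ρ) (ρ i) (const false)
      centre-flips x≢i x≢j change eq = xor-true≢ (∂ (minor F ρ) (ρ i) (const false)) (trans (sym (trans
        (∂-centre-unit x≢i x≢j) (cong (∂ (minor F ρ) (ρ i) (const false) xor_) change))) eq)

      varies-centre : Varies (minor F ρ) (ρ i)
      varies-centre = varies-at (unit (ρ (cycle i)))
        (centre-flips (cycle≢ i) (cycle-far far) (cong₂ _xor_ (adj-cycle i) (adj-far-cycle far)))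

      varies-everywhere : ∀ p → Varies (minor F ρ) (ρ p)
      varies-everywhere p with p ≟ i | p ≟ j
      ... | yes refl | _        = varies-centre
      ... | no _     | yes refl = subst (Varies (minor F ρ)) glued varies-centre
      ... | no p≢i   | no p≢j with neighbour-avoiding far p
      ...   | x , p~x , x≢i , x≢j = varies-single p≢i p≢j x≢i x≢j p~x

  -- A loop rules out join-irreducibility

  -- merged k l is a minor of F along a map identifying i and j, i.e. merged k l ≤ merged i j.
  FactorsThrough : Fin N → Fin N → Fin N → Fin N → Set
  FactorsThrough k l i j = ∃ λ ρ → ρ i ≡ ρ j × merged k l ≗ minor F ρ

  factorsThrough-swap : ∀ {k l i j} → FactorsThrough k l i j → FactorsThrough k l j i
  factorsThrough-swap (ρ , glued , agree) = ρ , sym glued , agree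

  varies-off-merged : ∀ {k s} → tri k ≢ tri s → ∀ w → w ≢ s → Varies (merged k s) w
  varies-off-merged {k} far w w≢s = subst (Varies (merged k _)) (identify-fixes k w≢s)
    (CollapsedMinor.AcrossTriangles.varies-everywhere (identify-collapse (≢-from-tri far)) far w)

  ¬factors-same : ∀ {i s} → tri i ≢ tri s → ¬ FactorsThrough i s i (cycle i)
  ¬factors-same {i} {s} far (ρ , glued , agree) =
    ¬varies-if-constant constant (varies-off-merged far (ρ i) (proj₂ collapse-misses i))
    where
    collapse-misses : Collapse ρ i (cycle i) × (∀ p → ρ p ≢ s)
    collapse-misses = collapse-if-minors-agree F-cong (identify i s) ρ agree
                        (λ w w≢s → varies⇒essential (varies-off-merged far w w≢s)) (cycle≢ i ∘ sym) glued
    constant : ∀ a → ∂ (merged i s) (ρ i) a ≡ (loop G i xor loop G (cycle i)) xor true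
    constant a = trans (∂-cong agree (ρ i) a) (CollapsedMinor.∂-centre-cycle (proj₁ collapse-misses) refl a)

  -- k has constant derivative 1 in merged k l, whereas in F ∘ ρ only the missing variable l has a
  -- constant derivative.
  ¬factors-looped : ∀ {v i j} → tri i ≢ tri j → loop G v ≡ true → loop G (cycle v) ≡ loop G (cycle (cycle v)) →
                    ¬ FactorsThrough (cycle v) (cycle (cycle v)) i j
  ¬factors-looped {v} {i} {j} far looped same-loops (ρ , glued , agree) =
    ¬varies-if-constant (λ a → trans (sym (∂-cong agree k a)) (π-constant a))
      (subst (Varies (minor F ρ)) (proj₂ k-hit)
             (CollapsedMinor.AcrossTriangles.varies-everywhere collapse far (proj₁ k-hit)))
    where
    open ≡-Reasoning
    k l : Fin N
    k = cycle v
    l = cycle k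
    k≢l : k ≢ l
    k≢l = cycle≢ k ∘ sym
    π : Fin N → Fin N
    π = identify k l
    module Π = CollapsedMinor (identify-collapse k≢l)
    π-constant : ∀ a → ∂ (minor F π) k a ≡ true
    π-constant a = begin
      ∂ (minor F π) k a                ≡⟨ cong (λ w → ∂ (minor F π) w a) (identify-fixes k k≢l) ⟨
      ∂ (minor F π) (π k) a            ≡⟨ Π.∂-centre-cycle refl a ⟩
      (loop G k xor loop G l) xor true ≡⟨ cong (λ b → (b xor loop G l) xor true) same-loops ⟩
      (loop G l xor loop G l) xor true ≡⟨ cong (_xor true) (xor-same (loop G l)) ⟩
      true                             ∎
    far-from-v : ∀ {w} → w ≢ v → w ≢ k → w ≢ l → tri w ≢ tri v
    far-from-v w≢v w≢k w≢l same with in-triangle same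
    ... | inj₁ w≡v        = w≢v w≡v
    ... | inj₂ (inj₁ w≡k) = w≢k w≡k
    ... | inj₂ (inj₂ w≡l) = w≢l w≡l
    essential : ∀ w → w ≢ l → Essential (minor F π) w
    essential w w≢l with w ≟ k | w ≟ v
    ... | yes refl | _        = essential-at (const false) (π-constant (const false))
    ... | no  w≢k  | yes refl = essential-at (const false) (begin
      ∂ (minor F π) w (const false)     ≡⟨ cong (λ u → ∂ (minor F π) u (const false)) (identify-fixes k w≢l) ⟨
      ∂ (minor F π) (π w) (const false) ≡⟨ Π.∂-single w≢k w≢l (const false) ⟩
      ∂ F w (const false)               ≡⟨ fG-∂-zero G w ⟩
      loop G w                          ≡⟨ looped ⟩
      true                              ∎)
    ... | no  w≢k  | no  w≢v  = varies⇒essential (subst (Varies (minor F π)) (identify-fixes k w≢l)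
          (Π.varies-single w≢k w≢l (cycle-far (λ eq → far-w (trans eq (tri-cycle v))))
                                   (cycle-far (λ eq → far-w (trans eq (tri-cycle² v))))
                                   (adj-cycle w)))
      where
      far-w : tri w ≢ tri v
      far-w = far-from-v w≢v w≢k w≢l
    collapse : Collapse ρ i j
    collapse = proj₁ (collapse-if-minors-agree F-cong π ρ agree essential (≢-from-tri far) glued)
    k-hit : ∃ λ p → ρ p ≡ k
    k-hit = essential⇒in-image F-cong π ρ agree (essential k k≢l)

  -- If ρ i = k the derivatives at 0 differ by the parity assumption.  Otherwise ρ i interacts in F ∘ ρ
  -- with the three images of cycle i, cycle² i and cycle j, but in merged k s only with the two
  -- images of its neighbours.
  ¬factors-parity : ∀ {i j k s} → tri i ≢ tri j → tri k ≢ tri s →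
                    loop G k xor loop G s ≢ loop G i xor loop G j → ¬ FactorsThrough k s i j
  ¬factors-parity {i} {j} {k} {s} far far′ parity (ρ , glued , agree) = at-centre (ρ i ≟ k)
    where
    open ≡-Reasoning
    k≢s : k ≢ s
    k≢s = ≢-from-tri far′
    π : Fin N → Fin N
    π = identify k s
    module Π = CollapsedMinor (identify-collapse k≢s)
    collapse-misses : Collapse ρ i j × (∀ p → ρ p ≢ s)
    collapse-misses = collapse-if-minors-agree F-cong π ρ agree
                        (λ w w≢s → varies⇒essential (varies-off-merged far′ w w≢s)) (≢-from-tri far) glued
    collapse : Collapse ρ i j
    collapse = proj₁ collapse-misses
    ρi≢s : ρ i ≢ s
    ρi≢s = proj₂ collapse-misses i
    open Collapse collapse using (injective-off)
    module P = CollapsedMinor.AcrossTriangles collapse far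
    ρi-fixed : π (ρ i) ≡ ρ i
    ρi-fixed = identify-fixes k ρi≢s
    far-cycle-j : tri i ≢ tri (cycle j)
    far-cycle-j eq = far (trans eq (tri-cycle j))
    Flipper : Fin N → Set
    Flipper c = ∃ λ x → ρ x ≡ c × x ≢ i × x ≢ j × adj G i x xor adj G j x ≡ true
    flipper₁ : Flipper (ρ (cycle i))
    flipper₁ = cycle i , refl , cycle≢ i , cycle-far far , cong₂ _xor_ (adj-cycle i) (adj-far-cycle far)
    flipper₂ : Flipper (ρ (cycle (cycle i)))
    flipper₂ = cycle (cycle i) , refl , cycle²≢ i , cycle²-far far ,
               cong₂ _xor_ (adj-cycle² i) (adj-far-cycle² far)
    flipper₃ : Flipper (ρ (cycle j))
    flipper₃ = cycle j , refl , cycle-far (far ∘ sym) , cycle≢ j ,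
               cong₂ _xor_ (adj-far-cycle (far ∘ sym)) (adj-cycle j)
    at-centre : Dec (ρ i ≡ k) → ⊥
    at-centre (yes ρi≡k) = parity (begin
      loop G k xor loop G s             ≡⟨ Π.AcrossTriangles.∂-centre-zero-loops far′ ⟨
      ∂ (minor F π) (π k) (const false) ≡⟨ cong (λ w → ∂ (minor F π) w (const false)) π-k ⟩
      ∂ (minor F π) (ρ i) (const false) ≡⟨ ∂-cong agree (ρ i) (const false) ⟩
      ∂ (minor F ρ) (ρ i) (const false) ≡⟨ P.∂-centre-zero-loops ⟩
      loop G i xor loop G j             ∎)
      where
      π-k : π k ≡ ρ i
      π-k = trans (identify-fixes k k≢s) (sym ρi≡k)
    at-centre (no ρi≢k) with one-of-three-avoids {P = Flipper} _≟_ flipper₁ flipper₂ flipper₃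
      (λ eq → cycle≢ (cycle i) (sym (injective-off (cycle-far far) (cycle²-far far) eq)))
      (λ eq → cycle-far far-cycle-j (injective-off (cycle-far far) (cycle≢ j) eq))
      (λ eq → cycle²-far far-cycle-j (injective-off (cycle²-far far) (cycle≢ j) eq))
      (π (cycle (ρ i))) (π (cycle (cycle (ρ i))))
    ... | _ , (x , refl , x≢i , x≢j , change) , c≢ , c≢′ = P.centre-flips x≢i x≢j change (begin
      ∂ (minor F ρ) (ρ i) (unit (ρ x))      ≡⟨ ∂-cong agree (ρ i) (unit (ρ x)) ⟨
      ∂ (minor F π) (ρ i) (unit (ρ x))      ≡⟨ cong (λ w → ∂ (minor F π) w (unit (ρ x))) ρi-fixed ⟨
      ∂ (minor F π) (π (ρ i)) (unit (ρ x))  ≡⟨ Π.∂-single-unit ρi≢k ρi≢s c≢ c≢′ ⟩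
      ∂ (minor F π) (π (ρ i)) (const false) ≡⟨ cong (λ w → ∂ (minor F π) w (const false)) ρi-fixed ⟩
      ∂ (minor F π) (ρ i) (const false)     ≡⟨ ∂-cong agree (ρ i) (const false) ⟩
      ∂ (minor F ρ) (ρ i) (const false)     ∎)

  -- For i, j in one triangle take i (oriented so that j = cycle i) and a vertex s of another triangle.
  -- Otherwise take the other two vertices of the triangle of v if their loops agree, and else one of
  -- them, chosen by parity, together with a vertex s of another triangle.
  some-pair-does-not-factor : ∀ {v} → loop G v ≡ true → ∀ {i j} → i ≢ j →
                              ∃₂ λ k l → k ≢ l × ¬ FactorsThrough k l i j
  some-pair-does-not-factor {v} looped {i} {j} i≢j with tri i ≟ tri j
  ... | yes same with in-triangle (sym same) | other-triangle (tri i)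
  ...   | inj₁ j≡i         | _         = contradiction (sym j≡i) i≢j
  ...   | inj₂ (inj₁ refl) | s , s-far = i , s , ≢-from-tri (s-far ∘ sym) , ¬factors-same (s-far ∘ sym)
  ...   | inj₂ (inj₂ refl) | s , s-far = j , s , ≢-from-tri far′ , λ factors →
          ¬factors-same far′ (subst (FactorsThrough j s j) (sym (cycle³ i)) (factorsThrough-swap factors))
    where
    far′ : tri (cycle (cycle i)) ≢ tri s
    far′ eq = s-far (trans (sym eq) (tri-cycle² i))
  some-pair-does-not-factor {v} looped {i} {j} i≢j | no far
    with loop G (cycle v) ≟ᵇ loop G (cycle (cycle v)) | other-triangle (tri v)
  ... | yes same-loops | _ =
        cycle v , cycle (cycle v) , cycle≢ (cycle v) ∘ sym , ¬factors-looped far looped same-loops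
  ... | no differ | s , s-far with xor-separates differ (loop G s) (loop G i xor loop G j)
  ...   | inj₁ parity = cycle v , s , ≢-from-tri far₁ , ¬factors-parity far far₁ parity
    where
    far₁ : tri (cycle v) ≢ tri s
    far₁ eq = s-far (trans (sym eq) (tri-cycle v))
  ...   | inj₂ parity = cycle (cycle v) , s , ≢-from-tri far₂ , ¬factors-parity far far₂ parity
    where
    far₂ : tri (cycle (cycle v)) ≢ tri s
    far₂ eq = s-far (trans (sym eq) (tri-cycle² v))

  loopless-if-joinIrreducible : JoinIrreducible (N , F) → Loopless G
  loopless-if-joinIrreducible ((m , h) , h≺F , below) v with loop G v in looped
  ... | false = refl
  ... | true with collision-if-strictly-below F-cong p₀ h≺F
  ...   | σ , h≗Fσ , i , j , i≢j , σi≡σj with some-pair-does-not-factor looped i≢j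
  ...     | k , l , k≢l , ¬factors with below (N , merged k l) (merged-strictly-below k≢l)
  ...       | τ , merged≗hτ =
              contradiction (τ ∘ σ , cong τ σi≡σj , λ a → trans (merged≗hτ a) (h≗Fσ (a ∘ τ))) ¬factors

  -- Without loops, one identification dominates all others

  module Relabel (α : Permutation′ n) (r : Fin n → Fin 3) where

    ψ ψ⁻¹ : Fin N → Fin N
    ψ u   = vertex (α ⟨$⟩ʳ tri u) (rotate (r (tri u)) (pos u))
    ψ⁻¹ u = vertex (α ⟨$⟩ˡ tri u) (rotate (negate (r (α ⟨$⟩ˡ tri u))) (pos u))

    ψ-vertex : ∀ t k → ψ (vertex t k) ≡ vertex (α ⟨$⟩ʳ t) (rotate (r t) k)
    ψ-vertex t k = cong₂ (λ t′ k′ → vertex (α ⟨$⟩ʳ t′) (rotate (r t′) k′)) (tri-vertex t k) (pos-vertex t k)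

    ψψ⁻¹ : ∀ u → ψ (ψ⁻¹ u) ≡ u
    ψψ⁻¹ u = trans (ψ-vertex _ _)
      (trans (cong₂ vertex (inverseʳ α) (negate-rotate (r (α ⟨$⟩ˡ tri u)) (pos u))) (vertex-tri-pos u))

    ψ⁻¹ψ : ∀ u → ψ⁻¹ (ψ u) ≡ u
    ψ⁻¹ψ u = begin
      ψ⁻¹ (ψ u)
        ≡⟨ cong₂ (λ t k → vertex (α ⟨$⟩ˡ t) (rotate (negate (r (α ⟨$⟩ˡ t))) k))
                 (tri-vertex _ _) (pos-vertex _ _) ⟩
      vertex (α ⟨$⟩ˡ (α ⟨$⟩ʳ t)) (rotate (negate (r (α ⟨$⟩ˡ (α ⟨$⟩ʳ t)))) (rotate (r t) (pos u)))
        ≡⟨ cong (λ t′ → vertex t′ (rotate (negate (r t′)) (rotate (r t) (pos u)))) (inverseˡ α) ⟩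
      vertex t (rotate (negate (r t)) (rotate (r t) (pos u)))
        ≡⟨ cong (vertex t) (rotate-negate (r t) (pos u)) ⟩
      vertex t (pos u)
        ≡⟨ vertex-tri-pos u ⟩
      u ∎
      where
      open ≡-Reasoning
      t : Fin n
      t = tri u

    ψ-cycle : ∀ u → ψ (cycle u) ≡ cycle (ψ u)
    ψ-cycle u = trans (ψ-vertex (tri u) (next (pos u)))
      (trans (cong (vertex (α ⟨$⟩ʳ tri u)) (rotate-next (r (tri u)) (pos u)))
             (sym (cong₂ (λ t k → vertex t (next k)) (tri-vertex _ _) (pos-vertex _ _))))

  module _ (loopless : Loopless G) where

    ∂F-loopless : ∀ w y → ∂ F w y ≡ y (cycle w) xor y (cycle (cycle w))
    ∂F-loopless w y =
      trans (∂F-neighbours w y) (cong (_xor (y (cycle w) xor y (cycle (cycle w)))) (loopless w))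

    module Automorphism {ψ ψ⁻¹ : Fin N → Fin N} (ψψ⁻¹ : ∀ u → ψ (ψ⁻¹ u) ≡ u) (ψ⁻¹ψ : ∀ u → ψ⁻¹ (ψ u) ≡ u)
                        (ψ-cycle : ∀ u → ψ (cycle u) ≡ cycle (ψ u)) where

      ψ-injective : Injective _≡_ _≡_ ψ
      ψ-injective {u} {v} eq = trans (sym (ψ⁻¹ψ u)) (trans (cong ψ⁻¹ eq) (ψ⁻¹ψ v))

      ∂-relabelled : ∀ w y → ∂ (minor F ψ) w y ≡ ∂ F w y
      ∂-relabelled w y = begin
        ∂ (minor F ψ) w y
          ≡⟨ cong (λ u → ∂ (minor F ψ) u y) (ψψ⁻¹ w) ⟨
        ∂ (minor F ψ) (ψ p) y
          ≡⟨ ∂-minor-single F-cong ψ (λ u → ψ-injective) y ⟩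
        ∂ F p (y ∘ ψ)
          ≡⟨ ∂F-loopless p (y ∘ ψ) ⟩
        y (ψ (cycle p)) xor y (ψ (cycle (cycle p)))
          ≡⟨ cong₂ (λ a b → y a xor y b) (ψ-cycle p) (trans (ψ-cycle (cycle p)) (cong cycle (ψ-cycle p))) ⟩
        y (cycle (ψ p)) xor y (cycle (cycle (ψ p)))
          ≡⟨ cong (λ u → y (cycle u) xor y (cycle (cycle u))) (ψψ⁻¹ w) ⟩
        y (cycle w) xor y (cycle (cycle w))
          ≡⟨ ∂F-loopless w y ⟨
        ∂ F w y ∎
        where
        open ≡-Reasoning
        p : Fin N
        p = ψ⁻¹ w

      invariant : minor F ψ ≗ F
      invariant y = xor≡false⇒≡
        (trans (constant-if-∂≡false difference-cong ∂difference y) (xor-same (F (const false))))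
        where
        difference : BF N
        difference x = minor F ψ x xor F x
        difference-cong : Congruent difference
        difference-cong x≗x′ = cong₂ _xor_ (F-cong (λ u → x≗x′ (ψ u))) (F-cong x≗x′)
        interchange : ∀ a b c d → (a xor b) xor (c xor d) ≡ (a xor c) xor (b xor d)
        interchange = solve-∀ boolRing
        ∂difference : ∀ w x → ∂ difference w x ≡ false
        ∂difference w x = trans (interchange (minor F ψ (toggle x w)) (F (toggle x w)) (minor F ψ x) (F x))
          (trans (cong (_xor ∂ F w x) (∂-relabelled w x)) (xor-same (∂ F w x)))

      merged-conjugate : ∀ x y → (N , merged (ψ x) (ψ y)) ≼ (N , merged x y)
      merged-conjugate x y = ψ , λ a →
        trans (sym (invariant (a ∘ identify (ψ x) (ψ y))))
              (F-cong (λ u → cong a (identify-commutes ψ-injective x y u)))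

    reach-across : ∀ {i j} → tri i ≢ tri j → (N , merged i j) ≼ (N , merged p₀ q₀)
    reach-across {i} {j} far =
      subst₂ (λ x y → (N , merged x y) ≼ (N , merged p₀ q₀)) ψp₀ ψq₀ (A.merged-conjugate p₀ q₀)
      where
      sending : Σ (Permutation′ n) λ α → α ⟨$⟩ʳ t₀ ≡ tri i × α ⟨$⟩ʳ t₁ ≡ tri j
      sending = permutation-sending t₀≢t₁ far
      r : Fin n → Fin 3
      r t = if does (t ≟ t₀) then pos i else pos j
      module R = Relabel (proj₁ sending) r
      module A = Automorphism R.ψψ⁻¹ R.ψ⁻¹ψ R.ψ-cycle
      r-t₀ : rotate (r t₀) zero ≡ pos i
      r-t₀ = trans (rotate-zero (r t₀)) (cong (if_then pos i else pos j) (dec-true (t₀ ≟ t₀) refl))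
      r-t₁ : rotate (r t₁) zero ≡ pos j
      r-t₁ = trans (rotate-zero (r t₁)) (cong (if_then pos i else pos j) (dec-false (t₁ ≟ t₀) (t₀≢t₁ ∘ sym)))
      ψp₀ : R.ψ p₀ ≡ i
      ψp₀ = trans (R.ψ-vertex t₀ zero) (trans (cong₂ vertex (proj₁ (proj₂ sending)) r-t₀) (vertex-tri-pos i))
      ψq₀ : R.ψ q₀ ≡ j
      ψq₀ = trans (R.ψ-vertex t₁ zero) (trans (cong₂ vertex (proj₂ (proj₂ sending)) r-t₁) (vertex-tri-pos j))

    -- The third vertex m of the triangle is inessential in merged i (cycle i); once m is merged into i
    -- as well, i becomes inessential too and can be sent to q.
    reach-within : ∀ {i q} → tri q ≢ tri i → (N , merged i (cycle i)) ≼ (N , merged i q)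
    reach-within {i} {q} far = merge ∘ identify q i , λ a → begin
      F (a ∘ identify i j)
        ≡⟨ insensitive-update F-cong (agree-off-m a) (flat-at-m a) ⟨
      F (a ∘ merge)
        ≡⟨ insensitive-update F-cong (agree-off-i a) (flat-at-i a) ⟨
      F (a ∘ merge ∘ identify q i)
        ≡⟨ F-cong (λ u → cong (a ∘ merge) (identify-∘-swap (≢-from-tri far) u)) ⟨
      F (a ∘ merge ∘ identify q i ∘ identify i q) ∎
      where
      open ≡-Reasoning
      j m : Fin N
      j = cycle i
      m = cycle j
      i≢j : i ≢ j
      i≢j = cycle≢ i ∘ sym
      i≢m : i ≢ m
      i≢m = cycle²≢ i ∘ sym
      merge : Fin N → Fin N
      merge = identify i m ∘ identify i j
      agree-off-m : ∀ a v → v ≢ m → a (merge v) ≡ a (identify i j v)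
      agree-off-m a v v≢m = cong a (identify-fixes i (identify-≢ i≢m v≢m))
      flat-at-m : ∀ a → ∂ F m (a ∘ identify i j) ≡ false
      flat-at-m a = begin
        ∂ F m (a ∘ identify i j)
          ≡⟨ ∂F-loopless m (a ∘ identify i j) ⟩
        a (identify i j (cycle m)) xor a (identify i j (cycle (cycle m)))
          ≡⟨ cong₂ (λ x y → a (identify i j x) xor a (identify i j y)) (cycle³ i) (cong cycle (cycle³ i)) ⟩
        a (identify i j i) xor a (identify i j j)
          ≡⟨ cong₂ (λ x y → a x xor a y) (identify-fixes i i≢j) (identify-l i j) ⟩
        a i xor a i
          ≡⟨ xor-same (a i) ⟩
        false ∎
      agree-off-i : ∀ a v → v ≢ i → a (merge (identify q i v)) ≡ a (merge v)
      agree-off-i a v v≢i = cong (a ∘ merge) (identify-fixes q v≢i)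
      flat-at-i : ∀ a → ∂ F i (a ∘ merge) ≡ false
      flat-at-i a = begin
        ∂ F i (a ∘ merge)
          ≡⟨ ∂F-loopless i (a ∘ merge) ⟩
        a (identify i m (identify i j j)) xor a (identify i m (identify i j m))
          ≡⟨ cong₂ (λ x y → a (identify i m x) xor a (identify i m y))
                   (identify-l i j) (identify-fixes i (cycle≢ j)) ⟩
        a (identify i m i) xor a (identify i m m)
          ≡⟨ cong₂ (λ x y → a x xor a y) (identify-fixes i i≢m) (identify-l i m) ⟩
        a i xor a i
          ≡⟨ xor-same (a i) ⟩
        false ∎

    reach : ∀ {i j} → i ≢ j → (N , merged i j) ≼ (N , merged p₀ q₀)
    reach {i} {j} i≢j with tri i ≟ tri j
    ... | no far = reach-across {i} {j} far
    ... | yes same with in-triangle (sym same) | other-triangle (tri i)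
    ...   | inj₁ j≡i         | _         = contradiction (sym j≡i) i≢j
    ...   | inj₂ (inj₁ refl) | s , s-far =
            ≼-trans {g = merged i s} {h = merged p₀ q₀}
              (reach-within {i} {s} s-far) (reach-across {i} {s} (s-far ∘ sym))
    ...   | inj₂ (inj₂ refl) | s , s-far =
            ≼-trans {g = merged j i} {h = merged p₀ q₀} (identify-swap-≼ F-cong i≢j)
              (≼-trans {g = merged j s} {h = merged p₀ q₀}
                 (subst (λ x → (N , merged j x) ≼ (N , merged j s)) (cycle³ i) (reach-within {j} {s} far′))
                 (reach-across {j} {s} (far′ ∘ sym)))
      where
      far′ : tri s ≢ tri (cycle (cycle i))
      far′ eq = s-far (trans eq (tri-cycle² i))

    joinIrreducible-if-loopless : JoinIrreducible (N , F)
    joinIrreducible-if-loopless = (N , merged p₀ q₀) , merged-strictly-below p₀≢q₀ , below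
      where
      below : ∀ g → g ≺ (N , F) → g ≼ (N , merged p₀ q₀)
      below (m , h) h≺F with collision-if-strictly-below F-cong p₀ h≺F
      ... | σ , h≗Fσ , i , j , i≢j , σi≡σj = ≼-trans {g = merged i j} {h = merged p₀ q₀} h≼merged (reach i≢j)
        where
        h≼merged : (m , h) ≼ (N , merged i j)
        h≼merged = σ , λ a → trans (h≗Fσ a) (F-cong (λ u → cong a (sym (identify-invisible {σ = σ} σi≡σj u))))

proposition4p13 : (N n : ℕ) → n ≥ 2 → (G : Graph N) → UnderlyingIsDisjointK3s G n →
    GraphJoinIrreducible G ⇔ Loopless G
proposition4p13 N n n≥2 G (e , adj⇔) = mk⇔ loopless-if-joinIrreducible joinIrreducible-if-loopless
  where open Triangles n≥2 G e adj⇔
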